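{- Let $u_0=[1,-1]$. Then (1) $OR_2\le^{acyc}_{con}\{NAND_2,u_0\}$, and (2) $NAND_2\le^{acyc}_{con}\{OR_2,u_0\}$.
   Context: Constraint functions are $f:\{0,1\}^k\to\mathbb{C}$; a symmetric function is written $[a_0,\dots,a_k]$ with $a_i$ its value on inputs with exactly $i$ ones, so $u_0(0)=1,u_0(1)=-1$, $OR_2=[0,1,1]$, $NAND_2=[1,1,0]$. A hypergraph is acyclic if repeatedly deleting vertices lying in at most one hyperedge and deleting hyperedges empty or contained in another yields the empty hypergraph. $f\le^{acyc}_{con}\mathcal{G}$ ($f$ of arity $k$ on $x_1,\dots,x_k$) means: there exist $\lambda\ne0$, auxiliary variables $y_1,\dots,y_m$ and finitely many constraints $(g_j,(z^j_1,\dots,z^j_{d_j}))$, $g_j\in\mathcal{G}$, $z^j_\ell\in\{x_1,\dots,x_k,y_1,\dots,y_m\}$, whose hypergraph (vertices $x$'s and $y$'s, hyperedges $\{z^j_1,\dots,z^j_{d_j}\}$) is acyclic, with $f(x)=\lambda\sum_{y\in\{0,1\}^m}\prod_j g_j(z^j_1,\dots,z^j_{d_j})$ for all $x$. -}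

module Defs where

open import Data.Bool using (Bool; true; false)
open import Data.Nat using (ℕ; zero; suc; _≤_)
open import Data.Fin using (Fin; zero; suc)
import Data.Fin.Properties as FinP
open import Data.Vec using (Vec; []; _∷_; lookup; toList)
import Data.Vec as Vec
open import Data.List using (List; []; _∷_; _++_; length; filter; map; allFin)
open import Data.List.Membership.Propositional using (_∈_)
open import Data.List.Membership.DecPropositional using () renaming (_∈?_ to mem?)
open import Data.List.Relation.Binary.Subset.Propositional using (_⊆_)
open import Data.Sum using (_⊎_; inj₁; inj₂)
import Data.Sum.Properties as SumP
open import Data.Product using (Σ; ∃; _×_; _,_)
open import Data.Rational using (ℚ; 0ℚ; 1ℚ; -_; _+_; _*_)
open import Relation.Nullary using (¬_; ¬?)
open import Relation.Binary.Definitions using (DecidableEquality)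
open import Relation.Binary.PropositionalEquality using (_≡_)
open import Relation.Binary.Construct.Closure.ReflexiveTransitive using (Star)

-- Constraint functions {0,1}^k → values (0 = false, 1 = true).
-- Values are taken in ℚ.

ConstraintFn : ℕ → Set
ConstraintFn k = Vec Bool k → ℚ

ones : ∀ {k} → Vec Bool k → Fin (suc k)
ones []          = zero
ones (false ∷ x) = Data.Fin.inject₁ (ones x)
ones (true  ∷ x) = suc (ones x)

-- symmetric function [a_0,…,a_k]: value a_i on inputs with exactly i ones
sym : ∀ {k} → Vec ℚ (suc k) → ConstraintFn k
sym a x = lookup a (ones x)

u₀ : ConstraintFn 1
u₀ = sym (1ℚ ∷ - 1ℚ ∷ [])

OR₂ : ConstraintFn 2
OR₂ = sym (0ℚ ∷ 1ℚ ∷ 1ℚ ∷ [])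

NAND₂ : ConstraintFn 2
NAND₂ = sym (1ℚ ∷ 1ℚ ∷ 0ℚ ∷ [])

record Family : Set₁ where
  field
    Idx   : Set
    arity : Idx → ℕ
    fn    : (i : Idx) → ConstraintFn (arity i)

pair : ∀ {a b} → ConstraintFn a → ConstraintFn b → Family
pair {a} {b} g h = record
  { Idx = Bool
  ; arity = λ { true → a ; false → b }
  ; fn = λ { true → g ; false → h } }

-- Hypergraphs and acyclicity (GYO reduction).

module Hypergraph {V : Set} (_≟_ : DecidableEquality V) where

  Edge : Set
  Edge = List V

  HG : Set
  HG = List V × List Edge

  remove : V → List V → List V
  remove v = filter (λ w → ¬? (v ≟ w))

  data Step : HG → HG → Set where
    delVertex : ∀ {vs es} v → v ∈ vs →
                length (filter (mem? _≟_ v) es) ≤ 1 →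
                Step (vs , es) (remove v vs , map (remove v) es)
    delEmpty  : ∀ {vs} pre post →
                Step (vs , pre ++ [] ∷ post) (vs , pre ++ post)
    delSub    : ∀ {vs} pre e post e' → e' ∈ pre ++ post → e ⊆ e' →
                Step (vs , pre ++ e ∷ post) (vs , pre ++ post)

  Acyclic : HG → Set
  Acyclic H = Star Step H ([] , [])

Var : ℕ → ℕ → Set
Var k m = Fin k ⊎ Fin m

_≟V_ : ∀ {k m} → DecidableEquality (Var k m)
_≟V_ = SumP.≡-dec FinP._≟_ FinP._≟_

record Constraint (𝒢 : Family) (k m : ℕ) : Set where
  constructor con
  field
    g     : Family.Idx 𝒢
    scope : Vec (Var k m) (Family.arity 𝒢 g)

val : ∀ {k m} → Vec Bool k → Vec Bool m → Var k m → Bool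
val x y (inj₁ i) = lookup x i
val x y (inj₂ j) = lookup y j

evalC : ∀ {𝒢 k m} → Vec Bool k → Vec Bool m → Constraint 𝒢 k m → ℚ
evalC {𝒢} x y (con g sc) = Family.fn 𝒢 g (Vec.map (val x y) sc)

prodC : ∀ {𝒢 k m} → Vec Bool k → Vec Bool m → List (Constraint 𝒢 k m) → ℚ
prodC x y []       = 1ℚ
prodC x y (c ∷ cs) = evalC x y c * prodC x y cs

sumAll : (m : ℕ) → (Vec Bool m → ℚ) → ℚ
sumAll zero    F = F []
sumAll (suc m) F = sumAll m (λ y → F (false ∷ y)) + sumAll m (λ y → F (true ∷ y))

hypergraph : ∀ {𝒢 k m} → List (Constraint 𝒢 k m) → List (Var k m) × List (List (Var k m))
hypergraph {𝒢} {k} {m} cs =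
  ( map inj₁ (allFin k) ++ map inj₂ (allFin m)
  , map (λ c → toList (Constraint.scope c)) cs )

record AcycGadget (𝒢 : Family) {k} (f : ConstraintFn k) : Set where
  field
    λ'          : ℚ
    λ'≢0        : ¬ (λ' ≡ 0ℚ)
    m           : ℕ
    constraints : List (Constraint 𝒢 k m)
    acyclic     : Hypergraph.Acyclic (_≟V_ {k} {m}) (hypergraph constraints)
    realizes    : ∀ (x : Vec Bool k) →
                  f x ≡ λ' * sumAll m (λ y → prodC x y constraints)

_≤acyc_ : ∀ {k} → ConstraintFn k → Family → Set
f ≤acyc 𝒢 = AcycGadget 𝒢 f

-- Both reductions use the same gadget: the binary function g is applied to
-- (x₁, y) and (x₂, y) and u₀ to the shared auxiliary y, so that
--   Σ_y g(x₁,y) g(x₂,y) u₀(y) = g(x₁,0) g(x₂,0) − g(x₁,1) g(x₂,1).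
-- For g = NAND₂ this is 1 − [x₁ = x₂ = 0] = OR₂(x₁,x₂); for g = OR₂ it is
-- x₁x₂ − 1 = −NAND₂(x₁,x₂).  The hypergraph {x₁y, x₂y, y} is a star, hence acyclic.
module Submission where

open import Defs
open import Data.Product using (_×_; _,_)
open import Data.Bool using (false; true)
open import Data.Nat using (z≤n; s≤s)
open import Data.Fin using (zero; suc)
open import Data.Vec using ([]; _∷_)
open import Data.List using (List; []; _∷_)
open import Data.List.Relation.Unary.Any using (here; there)
open import Data.Sum using (inj₁; inj₂)
open import Data.Rational using (ℚ; 0ℚ; 1ℚ; -_; _*_)
open import Relation.Nullary using (¬_)
open import Relation.Binary.PropositionalEquality using (_≡_; refl)
open import Relation.Binary.Construct.Closure.ReflexiveTransitive using (ε; _◅_)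

module _ (g : ConstraintFn 2) (u : ConstraintFn 1) where

  private
    x₁ x₂ y : Var 2 1
    x₁ = inj₁ zero
    x₂ = inj₁ (suc zero)
    y  = inj₂ zero

  starGadget : List (Constraint (pair g u) 2 1)
  starGadget = con true (x₁ ∷ y ∷ []) ∷ con true (x₂ ∷ y ∷ []) ∷ con false (y ∷ []) ∷ []

  starGadget-acyclic : Hypergraph.Acyclic (_≟V_ {2} {1}) (hypergraph starGadget)
  starGadget-acyclic =
    delSub ((x₁ ∷ y ∷ []) ∷ (x₂ ∷ y ∷ []) ∷ []) (y ∷ []) [] (x₁ ∷ y ∷ []) (here refl) there
    ◅ delVertex x₁ (here refl) (s≤s z≤n)
    ◅ delVertex x₂ (here refl) (s≤s z≤n)
    ◅ delSub [] (y ∷ []) ((y ∷ []) ∷ []) (y ∷ []) (here refl) (λ y∈ → y∈)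
    ◅ delVertex y (here refl) (s≤s z≤n)
    ◅ delEmpty [] []
    ◅ ε
    where open Hypergraph (_≟V_ {2} {1})

  ≤acyc-viaStarGadget : ∀ {f : ConstraintFn 2} (λ' : ℚ) → ¬ (λ' ≡ 0ℚ) →
    (∀ x → f x ≡ λ' * sumAll 1 (λ z → prodC x z starGadget)) → f ≤acyc pair g u
  ≤acyc-viaStarGadget λ' λ'≢0 realizes = record
    { λ' = λ' ; λ'≢0 = λ'≢0 ; m = 1 ; constraints = starGadget
    ; acyclic = starGadget-acyclic ; realizes = realizes }

lemma3p4 : (OR₂ ≤acyc pair NAND₂ u₀) × (NAND₂ ≤acyc pair OR₂ u₀)
lemma3p4 =
    ≤acyc-viaStarGadget NAND₂ u₀ 1ℚ (λ ())
      (λ { (false ∷ false ∷ []) → refl ; (false ∷ true ∷ []) → refl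
         ; (true ∷ false ∷ []) → refl ; (true ∷ true ∷ []) → refl })
  , ≤acyc-viaStarGadget OR₂ u₀ (- 1ℚ) (λ ())
      (λ { (false ∷ false ∷ []) → refl ; (false ∷ true ∷ []) → refl
         ; (true ∷ false ∷ []) → refl ; (true ∷ true ∷ []) → refl })
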